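{- For every even $r\ge 4$, $\zeta_e(BF(r))\le \left(\frac{r}{2}+2\right)2^{r-1}$.
   Context: The $r$-dimensional butterfly network $BF(r)$ has vertex set $\{[w;i] : w\in\{0,1\}^r,\ 0\le i\le r\}$, and $[w;i]$ is adjacent to $[w';j]$ iff $j=i+1$ and either $w=w'$ or $w$ and $w'$ differ precisely in the $j$-th bit. Forcing (closure) rule: for a graph $G=(V,E)$ and $T\subseteq V$, the closure $C_G(T)$ starts as $T$ and, as long as some vertex of $C_G(T)$ has exactly one neighbor not in $C_G(T)$, that neighbor is added. Edge-forcing set: a set $K$ of pairwise independent edges of $G$ such that, with $T$ the set of endpoints of edges of $K$, $C_G(T)=V$. $\zeta_e(G)$ is the minimum cardinality of an edge-forcing set of $G$. -}

module Defs where

open import Data.Nat using (ℕ; zero; suc)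
open import Data.Fin using (Fin; toℕ)
open import Data.Bool using (Bool; not)
open import Data.Vec using (Vec; lookup)
open import Data.Product using (Σ; _×_; _,_; proj₁; proj₂)
open import Data.Sum using (_⊎_)
open import Data.List using (List; length)
open import Data.List.Relation.Unary.Any using (Any)
open import Data.List.Relation.Unary.All using (All)
open import Data.List.Relation.Unary.AllPairs using (AllPairs)
open import Relation.Binary.PropositionalEquality using (_≡_; _≢_)
open import Relation.Nullary using (¬_)
open import Level using (0ℓ)

record Graph : Set₁ where
  field
    Vertex : Set
    Adj    : Vertex → Vertex → Set

module _ (G : Graph) where
  open Graph G

  -- It is the least set containing T and closed under the forcing rule:
  -- if u is in the closure, v is a neighbour of u and every neighbour of
  -- u other than v is in the closure, then v is in the closure.
  -- (This is exactly the final result of the iterative forcing process.)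
  data Closure (T : Vertex → Set) : Vertex → Set where
    base  : ∀ {v} → T v → Closure T v
    force : ∀ {u v} → Closure T u → Adj u v →
            (∀ w → Adj u w → w ≢ v → Closure T w) → Closure T v

  Edge : Set
  Edge = Σ (Vertex × Vertex) (λ p → Adj (proj₁ p) (proj₂ p))

  endpointOf : Vertex → Edge → Set
  endpointOf v ((a , b) , _) = (v ≡ a) ⊎ (v ≡ b)

  Independent : Edge → Edge → Set
  Independent e f = ∀ v → endpointOf v e → ¬ endpointOf v f

  Endpoints : List Edge → Vertex → Set
  Endpoints K v = Any (endpointOf v) K

  -- Pairwise independence (for
  -- distinct list positions) forces the list entries to be distinct
  -- edges, so the length of K is its cardinality.
  IsEdgeForcingSet : List Edge → Set
  IsEdgeForcingSet K =
    AllPairs Independent K × (∀ v → Closure (Endpoints K) v)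

-- The r-dimensional butterfly network BF(r).
-- Vertices [w;i] with w ∈ {0,1}^r and 0 ≤ i ≤ r.
-- Bits are numbered 1..r; bit number j is stored at Fin-index j-1.

BFVertex : ℕ → Set
BFVertex r = Vec Bool r × Fin (suc r)

DiffExactlyAt : ∀ {r} → Vec Bool r → Vec Bool r → ℕ → Set
DiffExactlyAt {r} w w' j =
  ∀ (k : Fin r) →
    (suc (toℕ k) ≡ j → lookup w' k ≡ not (lookup w k)) ×
    (suc (toℕ k) ≢ j → lookup w' k ≡ lookup w k)

BFArc : ∀ r → BFVertex r → BFVertex r → Set
BFArc r (w , i) (w' , j) =
  (toℕ j ≡ suc (toℕ i)) × ((w ≡ w') ⊎ DiffExactlyAt w w' (toℕ j))

BF : ℕ → Graph
BF r = record
  { Vertex = BFVertex r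
  ; Adj    = λ x y → BFArc r x y ⊎ BFArc r y x
  }

{-# OPTIONS --safe #-}
-- Take straight edges ("rungs") [w;i]—[w;i+1]: all of them at level 0, those with
-- even-parity words at the even levels 2, 4, …, r-2, and those with odd-parity words
-- at level r-1.  Rungs at consecutive levels never share a word, so they are
-- independent, and there are (2 + (r/2 - 1) + 1) · 2^(r-1) of them.  Levels 0 and 1
-- are covered; at every higher level i the vertices [w;i] of one parity are
-- endpoints, and each remaining [w;i] is forced by [w;i-1], whose only other
-- undetermined neighbour [w';i] (w' = w with bit i flipped) has the covered parity.
module Submission where

open import Defs
open import Data.Nat using (ℕ; zero; suc; pred; _≤_; _+_; _*_; _^_; _∸_; _<_; z≤n; s≤s)
open import Data.Nat.Properties using (+-identityʳ; +-comm; ≤-reflexive; <-trans)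
open import Data.Nat.DivMod using (_/_; m*n/n≡m)
open import Data.Nat.Divisibility using (_∣_; divides)
open import Data.Bool using (Bool; true; false; not; _xor_; _≟_)
open import Data.Bool.Properties using (not-involutive; ¬-not; not-distribˡ-xor; not-distribʳ-xor)
open import Data.Vec using (Vec; []; _∷_; lookup)
open import Data.Vec.Properties using (∷-injectiveʳ)
open import Data.Fin using (Fin; zero; suc; toℕ; inject₁; _↑ʳ_)
open import Data.Fin.Properties using (toℕ-injective; toℕ-inject₁; inject₁-injective; toℕ<n)
  renaming (suc-injective to fsuc-injective)
open import Data.List using (List; []; _∷_; map; _++_; length)
open import Data.List.Properties using (length-map; length-++)
open import Data.List.Membership.Propositional using (_∈_)
open import Data.List.Membership.Propositional.Properties using (∈-map⁺; ∈-map⁻; ∈-++⁺ˡ; ∈-++⁺ʳ; ∈-++⁻)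
open import Data.List.Relation.Unary.Any using (here; there)
import Data.List.Relation.Unary.Any as Any
open import Data.List.Relation.Unary.All using (All; []; _∷_)
import Data.List.Relation.Unary.All as All
import Data.List.Relation.Unary.All.Properties as All
open import Data.List.Relation.Unary.AllPairs using (AllPairs; []; _∷_)
import Data.List.Relation.Unary.AllPairs.Properties as AllPairs
open import Data.List.Relation.Unary.Unique.Propositional using (Unique)
import Data.List.Relation.Unary.Unique.Propositional.Properties as Unique
open import Data.Product using (Σ; _×_; _,_; proj₁; proj₂; map₁)
open import Data.Product.Properties using (,-injectiveˡ; ,-injectiveʳ)
open import Data.Sum using (_⊎_; inj₁; inj₂)
import Data.Sum as Sum
open import Function using (_∘_)
open import Relation.Binary.PropositionalEquality
open import Relation.Nullary using (¬_; yes; no)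
open import Data.Empty using (⊥; ⊥-elim)

unique⇒allPairs : ∀ {A : Set} {R : A → A → Set} {xs : List A} →
                  (∀ {x y} → x ∈ xs → y ∈ xs → x ≢ y → R x y) → Unique xs → AllPairs R xs
unique⇒allPairs related []          = []
unique⇒allPairs related (x∉ ∷ uxs) =
  All.tabulate (λ y∈ → related (here refl) (there y∈) (All.lookup x∉ y∈)) ∷
  unique⇒allPairs (λ x∈ y∈ → related (there x∈) (there y∈)) uxs

parity : ∀ {n} → Vec Bool n → Bool
parity []      = false
parity (b ∷ w) = b xor parity w

parity-cong : ∀ {n} (w w' : Vec Bool n) → (∀ k → lookup w' k ≡ lookup w k) → parity w' ≡ parity w
parity-cong []      []       _  = refl
parity-cong (_ ∷ w) (_ ∷ w') eq = cong₂ _xor_ (eq zero) (parity-cong w w' (eq ∘ suc))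

DiffExactlyAt-tail : ∀ {n a a'} {w w' : Vec Bool n} {j} →
                     DiffExactlyAt (a ∷ w) (a' ∷ w') (suc j) → DiffExactlyAt w w' j
DiffExactlyAt-tail d k = (λ e → proj₁ (d (suc k)) (cong suc e))
                       , (λ ne → proj₂ (d (suc k)) (ne ∘ cong pred))

parity-flip : ∀ {n} (w w' : Vec Bool n) (i : Fin n) →
              DiffExactlyAt w w' (suc (toℕ i)) → parity w' ≡ not (parity w)
parity-flip (a ∷ w) (a' ∷ w') zero d = begin
  a' xor parity w'   ≡⟨ cong₂ _xor_ (proj₁ (d zero) refl) (parity-cong w w' (λ k → proj₂ (d (suc k)) λ ())) ⟩
  not a xor parity w ≡⟨ not-distribˡ-xor a (parity w) ⟨
  not (parity (a ∷ w)) ∎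
  where open ≡-Reasoning
parity-flip (a ∷ w) (a' ∷ w') (suc i) d = begin
  a' xor parity w'     ≡⟨ cong₂ _xor_ (proj₂ (d zero) λ ()) (parity-flip w w' i (DiffExactlyAt-tail d)) ⟩
  a xor not (parity w) ≡⟨ not-distribʳ-xor a (parity w) ⟨
  not (parity (a ∷ w)) ∎
  where open ≡-Reasoning

wordsOfParity : ∀ n → Bool → List (Vec Bool n)
wordsOfParity zero    false = [] ∷ []
wordsOfParity zero    true  = []
wordsOfParity (suc n) p     = map (false ∷_) (wordsOfParity n p) ++ map (true ∷_) (wordsOfParity n (not p))

∈-wordsOfParity⁺ : ∀ {n} (w : Vec Bool n) → w ∈ wordsOfParity n (parity w)
∈-wordsOfParity⁺ []          = here refl
∈-wordsOfParity⁺ (false ∷ w) = ∈-++⁺ˡ (∈-map⁺ (false ∷_) (∈-wordsOfParity⁺ w))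
∈-wordsOfParity⁺ (true ∷ w)  = ∈-++⁺ʳ _ (∈-map⁺ (true ∷_)
  (subst (λ p → w ∈ wordsOfParity _ p) (sym (not-involutive (parity w))) (∈-wordsOfParity⁺ w)))

∈-wordsOfParity⁻ : ∀ {n p} {w : Vec Bool n} → w ∈ wordsOfParity n p → parity w ≡ p
∈-wordsOfParity⁻ {zero} {false} (here refl) = refl
∈-wordsOfParity⁻ {suc n} {p} w∈ with ∈-++⁻ (map (false ∷_) (wordsOfParity n p)) w∈
... | inj₁ w∈₀ with ∈-map⁻ (false ∷_) w∈₀
...   | _ , u∈ , refl = ∈-wordsOfParity⁻ u∈
∈-wordsOfParity⁻ {suc n} {p} w∈ | inj₂ w∈₁ with ∈-map⁻ (true ∷_) w∈₁
...   | _ , u∈ , refl = trans (cong not (∈-wordsOfParity⁻ u∈)) (not-involutive p)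

wordsOfParity-unique : ∀ n p → Unique (wordsOfParity n p)
wordsOfParity-unique zero    false = [] ∷ []
wordsOfParity-unique zero    true  = []
wordsOfParity-unique (suc n) p     = Unique.++⁺
  (Unique.map⁺ ∷-injectiveʳ (wordsOfParity-unique n p))
  (Unique.map⁺ ∷-injectiveʳ (wordsOfParity-unique n (not p)))
  heads-differ
  where
  heads-differ : ∀ {v} → ¬ (v ∈ map (false ∷_) (wordsOfParity n p) × v ∈ map (true ∷_) (wordsOfParity n (not p)))
  heads-differ (v∈₀ , v∈₁) with ∈-map⁻ (false ∷_) v∈₀ | ∈-map⁻ (true ∷_) v∈₁
  ... | _ , _ , refl | _ , _ , ()

length-wordsOfParity : ∀ n p → length (wordsOfParity (suc n) p) ≡ 2 ^ n
length-wordsOfParity zero    false = refl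
length-wordsOfParity zero    true  = refl
length-wordsOfParity (suc n) p     = begin
  length (map (false ∷_) (wordsOfParity (suc n) p) ++ map (true ∷_) (wordsOfParity (suc n) (not p)))
    ≡⟨ length-++ (map (false ∷_) (wordsOfParity (suc n) p)) {map (true ∷_) (wordsOfParity (suc n) (not p))} ⟩
  length (map (false ∷_) (wordsOfParity (suc n) p)) + length (map (true ∷_) (wordsOfParity (suc n) (not p)))
    ≡⟨ cong₂ _+_ (trans (length-map (false ∷_) (wordsOfParity (suc n) p)) (length-wordsOfParity n p))
                 (trans (length-map (true ∷_) (wordsOfParity (suc n) (not p))) (length-wordsOfParity n (not p))) ⟩
  2 ^ n + 2 ^ n
    ≡⟨ cong (2 ^ n +_) (+-identityʳ (2 ^ n)) ⟨
  2 ^ suc n ∎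
  where open ≡-Reasoning

module _ {r : ℕ} where

  rung : Vec Bool r × Fin r → Edge (BF r)
  rung (w , i) = ((w , inject₁ i) , (w , suc i)) , inj₁ (cong suc (sym (toℕ-inject₁ i)) , inj₁ refl)

  rung-independent : ∀ {w w' i i'} → (w , i) ≢ (w' , i') →
                     (w ≡ w' → suc i ≢ inject₁ i') → (w ≡ w' → suc i' ≢ inject₁ i) →
                     Independent (BF r) (rung (w , i)) (rung (w' , i'))
  rung-independent ≢key _ _ _ (inj₁ refl) (inj₁ e) =
    ≢key (cong₂ _,_ (,-injectiveˡ e) (inject₁-injective (,-injectiveʳ e)))
  rung-independent ≢key _ _ _ (inj₂ refl) (inj₂ e) =
    ≢key (cong₂ _,_ (,-injectiveˡ e) (fsuc-injective (,-injectiveʳ e)))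
  rung-independent _ _ ¬below _ (inj₁ refl) (inj₂ e) = ¬below (,-injectiveˡ e) (sym (,-injectiveʳ e))
  rung-independent _ ¬above _ _ (inj₂ refl) (inj₁ e) = ¬above (,-injectiveˡ e) (,-injectiveʳ e)

  -- A slot (i , p) stands for the rungs at level i on all words of parity p.
  rungKeys : List (Fin r × Bool) → List (Vec Bool r × Fin r)
  rungKeys []             = []
  rungKeys ((i , p) ∷ ss) = map (_, i) (wordsOfParity r p) ++ rungKeys ss

  ladder : List (Fin r × Bool) → List (Edge (BF r))
  ladder ss = map rung (rungKeys ss)

  ∈-rungKeys⁺ : ∀ {ss w i} → (i , parity w) ∈ ss → (w , i) ∈ rungKeys ss
  ∈-rungKeys⁺ {_ ∷ _}       {w} (here refl) = ∈-++⁺ˡ (∈-map⁺ (_, _) (∈-wordsOfParity⁺ w))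
  ∈-rungKeys⁺ {(i , p) ∷ _} (there s∈) = ∈-++⁺ʳ (map (_, i) (wordsOfParity r p)) (∈-rungKeys⁺ s∈)

  ∈-rungKeys⁻ : ∀ {ss w i} → (w , i) ∈ rungKeys ss → (i , parity w) ∈ ss
  ∈-rungKeys⁻ {(i , p) ∷ ss} k∈ with ∈-++⁻ (map (_, i) (wordsOfParity r p)) k∈
  ... | inj₂ k∈ss = there (∈-rungKeys⁻ k∈ss)
  ... | inj₁ k∈ws with ∈-map⁻ (_, i) k∈ws
  ...   | _ , w∈ , refl = here (cong (i ,_) (∈-wordsOfParity⁻ w∈))

  rungKeys-unique : ∀ {ss} → Unique ss → Unique (rungKeys ss)
  rungKeys-unique {[]}           []          = []
  rungKeys-unique {(i , p) ∷ ss} (s∉ ∷ uss) = Unique.++⁺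
    (Unique.map⁺ ,-injectiveˡ (wordsOfParity-unique r p))
    (rungKeys-unique uss)
    λ (k∈ws , k∈ss) → slot-repeated k∈ws (∈-rungKeys⁻ k∈ss)
    where
    slot-repeated : ∀ {w j} → (w , j) ∈ map (_, i) (wordsOfParity r p) → (j , parity w) ∈ ss → ⊥
    slot-repeated k∈ws s∈ with ∈-map⁻ (_, i) k∈ws
    ... | _ , w∈ , refl = All.lookup s∉ (subst (λ q → (i , q) ∈ ss) (∈-wordsOfParity⁻ w∈) s∈) refl

  NoStacking : List (Fin r × Bool) → Set
  NoStacking ss = ∀ {i i' p} → (i , p) ∈ ss → (i' , p) ∈ ss → suc i ≢ inject₁ i'

  ladder-independent : ∀ {ss} → Unique ss → NoStacking ss → AllPairs (Independent (BF r)) (ladder ss)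
  ladder-independent {ss} uss noStack = AllPairs.map⁺ (unique⇒allPairs independent (rungKeys-unique uss))
    where
    independent : ∀ {k k'} → k ∈ rungKeys ss → k' ∈ rungKeys ss → k ≢ k' → Independent (BF r) (rung k) (rung k')
    independent {_ , _} {_ , _} k∈ k'∈ k≢k' = rung-independent k≢k'
      (λ { refl → noStack (∈-rungKeys⁻ k∈) (∈-rungKeys⁻ k'∈) })
      (λ { refl → noStack (∈-rungKeys⁻ k'∈) (∈-rungKeys⁻ k∈) })

  Covers : List (Fin r × Bool) → Fin (suc r) → Bool → Set
  Covers ss v p = Σ (Fin r) λ i → (i , p) ∈ ss × (inject₁ i ≡ v ⊎ suc i ≡ v)

  covers⇒endpoint : ∀ {ss v w} → Covers ss v (parity w) → Endpoints (BF r) (ladder ss) (w , v)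
  covers⇒endpoint (i , s∈ , inj₁ refl) = Any.map (λ { refl → inj₁ refl }) (∈-map⁺ rung (∈-rungKeys⁺ s∈))
  covers⇒endpoint (i , s∈ , inj₂ refl) = Any.map (λ { refl → inj₂ refl }) (∈-map⁺ rung (∈-rungKeys⁺ s∈))

length-rungKeys : ∀ {n} (ss : List (Fin (suc n) × Bool)) → length (rungKeys ss) ≡ length ss * 2 ^ n
length-rungKeys     []             = refl
length-rungKeys {n} ((i , p) ∷ ss) = begin
  length (map (_, i) (wordsOfParity (suc n) p) ++ rungKeys ss)
    ≡⟨ length-++ (map (_, i) (wordsOfParity (suc n) p)) {rungKeys ss} ⟩
  length (map (_, i) (wordsOfParity (suc n) p)) + length (rungKeys ss)
    ≡⟨ cong₂ _+_ (trans (length-map (_, i) (wordsOfParity (suc n) p)) (length-wordsOfParity n p))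
                 (length-rungKeys ss) ⟩
  2 ^ n + length ss * 2 ^ n ∎
  where open ≡-Reasoning

module _ {r : ℕ} (T : BFVertex r → Set) (bottom : ∀ w → T (w , zero))
         (layer : ∀ (i : Fin r) → Σ Bool λ p → ∀ w → parity w ≡ p → T (w , suc i)) where

  closed-below : ∀ n w (j : Fin (suc r)) → toℕ j < n → Closure (BF r) T (w , j)
  closed-below (suc n) w zero    _           = base (bottom w)
  closed-below (suc n) w (suc i) (s≤s i<n) with parity w ≟ proj₁ (layer i)
  ... | yes pw = base (proj₂ (layer i) w pw)
  ... | no ¬pw = force (closed-below n w (inject₁ i) (subst (_< n) (sym (toℕ-inject₁ i)) i<n))
                       (proj₂ (rung (w , i)))
                       others
    where
    above : ∀ {k} → toℕ k ≡ suc (toℕ (inject₁ i)) → k ≡ suc i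
    above e = toℕ-injective (trans e (cong suc (toℕ-inject₁ i)))
    others : ∀ x → Graph.Adj (BF r) (w , inject₁ i) x → x ≢ (w , suc i) → Closure (BF r) T x
    others (w' , k) (inj₂ (e , _)) _ =
      closed-below n w' k (<-trans (≤-reflexive (trans (sym e) (toℕ-inject₁ i))) i<n)
    others _ (inj₁ (e , inj₁ refl)) x≢ = ⊥-elim (x≢ (cong (w ,_) (above e)))
    others (w' , k) (inj₁ (e , inj₂ d)) _ with above e
    ... | refl = base (proj₂ (layer i) w' (trans (parity-flip w w' i d) (sym (¬-not (¬pw ∘ sym)))))

  closure-complete : ∀ v → Closure (BF r) T v
  closure-complete (w , j) = closed-below (suc r) w j (toℕ<n j)

two : ∀ {n} → Fin (suc (suc (suc n)))
two = suc (suc zero)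

-- For r = 2m + 4: parity false at the levels 2, 4, …, r-2 and parity true at level r-1.
upperSlots : ∀ m → List (Fin (suc (suc m) * 2) × Bool)
upperSlots zero    = (two , false) ∷ (suc two , true) ∷ []
upperSlots (suc m) = (two , false) ∷ map (map₁ (2 ↑ʳ_)) (upperSlots m)

slots : ∀ m → List (Fin (suc (suc m) * 2) × Bool)
slots m = (zero , false) ∷ (zero , true) ∷ upperSlots m

length-upperSlots : ∀ m → length (upperSlots m) ≡ suc (suc m)
length-upperSlots zero    = refl
length-upperSlots (suc m) = cong suc (trans (length-map (map₁ (2 ↑ʳ_)) (upperSlots m)) (length-upperSlots m))

length-slots : ∀ m → length (slots m) ≡ suc (suc m) + 2
length-slots m = trans (cong (2 +_) (length-upperSlots m)) (+-comm 2 (suc (suc m)))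

upperSlots-≥2 : ∀ m → All (λ s → 2 ≤ toℕ (proj₁ s)) (upperSlots m)
upperSlots-≥2 zero    = s≤s (s≤s z≤n) ∷ s≤s (s≤s z≤n) ∷ []
upperSlots-≥2 (suc m) = s≤s (s≤s z≤n) ∷ All.map⁺ (All.universal (λ _ → s≤s (s≤s z≤n)) (upperSlots m))

∈-upperSlots⇒≥2 : ∀ {m i p} → (i , p) ∈ upperSlots m → 2 ≤ toℕ i
∈-upperSlots⇒≥2 {m} s∈ = All.lookup (upperSlots-≥2 m) s∈

≥2⇒inject₁≢one : ∀ {n} {i : Fin (suc n)} → 2 ≤ toℕ i → inject₁ i ≢ suc zero
≥2⇒inject₁≢one {i = i} i≥2 e with subst (2 ≤_) (trans (sym (toℕ-inject₁ i)) (cong toℕ e)) i≥2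
... | s≤s ()

∈-lifted⁻ : ∀ {n} {ss : List (Fin n × Bool)} {i p} →
            (i , p) ∈ map (map₁ (2 ↑ʳ_)) ss → Σ (Fin n) λ j → i ≡ suc (suc j) × (j , p) ∈ ss
∈-lifted⁻ s∈ with ∈-map⁻ (map₁ (2 ↑ʳ_)) s∈
... | (j , _) , j∈ , refl = j , refl , j∈

upperSlots-unique : ∀ m → Unique (upperSlots m)
upperSlots-unique zero    = ((λ ()) ∷ []) ∷ [] ∷ []
upperSlots-unique (suc m) = All.tabulate two-not-lifted ∷ Unique.map⁺ lift-injective (upperSlots-unique m)
  where
  two-not-lifted : ∀ {s} → s ∈ map (map₁ (2 ↑ʳ_)) (upperSlots m) → (two , false) ≢ s
  two-not-lifted s∈ refl with ∈-lifted⁻ s∈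
  ... | _ , refl , j∈ with () ← ∈-upperSlots⇒≥2 j∈
  lift-injective : ∀ {s s' : Fin (suc (suc m) * 2) × Bool} → map₁ (2 ↑ʳ_) s ≡ map₁ (2 ↑ʳ_) s' → s ≡ s'
  lift-injective {_ , _} {_ , _} refl = refl

slots-unique : ∀ m → Unique (slots m)
slots-unique m =
  ((λ ()) ∷ All.map not-bottom (upperSlots-≥2 m)) ∷ All.map not-bottom (upperSlots-≥2 m) ∷ upperSlots-unique m
  where
  not-bottom : ∀ {p} {s : Fin (suc (suc m) * 2) × Bool} → 2 ≤ toℕ (proj₁ s) → (zero , p) ≢ s
  not-bottom () refl

upperSlots-noStacking : ∀ m → NoStacking (upperSlots m)
upperSlots-noStacking zero    (here refl)         (here refl)         ()
upperSlots-noStacking zero    (here refl)         (there (here ()))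
upperSlots-noStacking zero    (here refl)         (there (there ()))
upperSlots-noStacking zero    (there (here refl)) (there (here refl)) ()
upperSlots-noStacking (suc m) (here refl)         (here refl)         ()
upperSlots-noStacking (suc m) (here refl)         (there i'∈)         e with ∈-lifted⁻ i'∈
... | _ , refl , j∈ = ≥2⇒inject₁≢one (∈-upperSlots⇒≥2 j∈) (sym (fsuc-injective (fsuc-injective e)))
upperSlots-noStacking (suc m) (there i∈)          (here refl)         e with ∈-lifted⁻ i∈
... | _ , refl , _ with () ← e
upperSlots-noStacking (suc m) (there i∈)          (there i'∈)         e with ∈-lifted⁻ i∈ | ∈-lifted⁻ i'∈
... | _ , refl , j∈ | _ , refl , j'∈ = upperSlots-noStacking m j∈ j'∈ (fsuc-injective (fsuc-injective e))

slots-noStacking : ∀ m → NoStacking (slots m)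
slots-noStacking m (here refl)         (here refl)         ()
slots-noStacking m (here refl)         (there (there i'∈)) e = ≥2⇒inject₁≢one (∈-upperSlots⇒≥2 i'∈) (sym e)
slots-noStacking m (there (here refl)) (there (here refl)) ()
slots-noStacking m (there (here refl)) (there (there i'∈)) e = ≥2⇒inject₁≢one (∈-upperSlots⇒≥2 i'∈) (sym e)
slots-noStacking m (there (there _))   (here refl)         ()
slots-noStacking m (there (there _))   (there (here refl)) ()
slots-noStacking m (there (there i∈))  (there (there i'∈)) = upperSlots-noStacking m i∈ i'∈

slots-bottom : ∀ m p → Covers (slots m) zero p
slots-bottom m false = zero , here refl , inj₁ refl
slots-bottom m true  = zero , there (here refl) , inj₁ refl

upperSlots-cover : ∀ m (u : Fin (suc (suc (suc (m * 2))))) → Σ Bool (Covers (upperSlots m) (suc (suc u)))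
upperSlots-cover zero    zero             = false , two , here refl , inj₁ refl
upperSlots-cover zero    (suc zero)       = false , two , here refl , inj₂ refl
upperSlots-cover zero    (suc (suc zero)) = true , suc two , there (here refl) , inj₂ refl
upperSlots-cover (suc m) zero             = false , two , here refl , inj₁ refl
upperSlots-cover (suc m) (suc zero)       = false , two , here refl , inj₂ refl
upperSlots-cover (suc m) (suc (suc u)) with upperSlots-cover m u
... | p , j , j∈ , at = p , suc (suc j) , there (∈-map⁺ (map₁ (2 ↑ʳ_)) j∈)
                      , Sum.map (cong (2 ↑ʳ_)) (cong (2 ↑ʳ_)) at

slots-cover : ∀ m (i : Fin (suc (suc m) * 2)) → Σ Bool (Covers (slots m) (suc i))
slots-cover m zero    = false , zero , here refl , inj₂ refl
slots-cover m (suc u) with upperSlots-cover m u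
... | p , j , j∈ , at = p , j , there (there j∈) , at

ladder-isEdgeForcingSet : ∀ m → IsEdgeForcingSet (BF (suc (suc m) * 2)) (ladder (slots m))
ladder-isEdgeForcingSet m =
  ladder-independent (slots-unique m) (slots-noStacking m) ,
  closure-complete (Endpoints (BF _) (ladder (slots m)))
    (λ w → covers⇒endpoint (slots-bottom m (parity w)))
    (λ i → proj₁ (slots-cover m i) ,
           λ w pw → covers⇒endpoint (subst (Covers (slots m) (suc i)) (sym pw) (proj₂ (slots-cover m i))))

length-ladder : ∀ m → length (ladder (slots m)) ≡ (suc (suc m) * 2 / 2 + 2) * 2 ^ (suc (suc m) * 2 ∸ 1)
length-ladder m = begin
  length (map rung (rungKeys (slots m))) ≡⟨ length-map rung (rungKeys (slots m)) ⟩
  length (rungKeys (slots m))            ≡⟨ length-rungKeys (slots m) ⟩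
  length (slots m) * N                   ≡⟨ cong (_* N) (length-slots m) ⟩
  (suc (suc m) + 2) * N                  ≡⟨ cong (λ q → (q + 2) * N) (m*n/n≡m (suc (suc m)) 2) ⟨
  (suc (suc m) * 2 / 2 + 2) * N          ∎
  where
  open ≡-Reasoning
  N : ℕ
  N = 2 ^ (suc (suc m) * 2 ∸ 1)

lemma4p10 : (r : ℕ) → 2 ∣ r → 4 ≤ r →
    Σ (List (Edge (BF r))) (λ K →
      IsEdgeForcingSet (BF r) K × length K ≤ (r / 2 + 2) * 2 ^ (r ∸ 1))
lemma4p10 .(0 * 2)           (divides zero          refl) ()
lemma4p10 .(1 * 2)           (divides (suc zero)    refl) (s≤s (s≤s ()))
lemma4p10 .(suc (suc m) * 2) (divides (suc (suc m)) refl) _ =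
  ladder (slots m) , ladder-isEdgeForcingSet m , ≤-reflexive (length-ladder m)
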